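{- If $a$ is a binary sequence of length $3$, then $a\odot M_I(3)^*$ represents the same configuration as $a'\odot M_I(3)^*$ for some $a'\in\{000,111\}$. Moreover, $000\odot M_I(3)^*$ and $111\odot M_I(3)^*$ represent different configurations.
   Context: $M_I(3)$ is the $3\times3$ binary matrix with rows $(1,1,0),(0,1,1),(1,0,1)$; $M^*$ is $M$ with a last all-zero column appended. For $a=a_1\dots a_k$, $a\odot M$ complements (exchanges $0$ and $1$ in) each row $i$ of $M$ with $a_i=1$. Two matrices represent the same configuration if they are equal up to permutations of rows and of columns. -}

module Defs where

open import Data.Nat as ℕ using (ℕ; suc)
open import Data.Bool using (Bool; true; false; not; if_then_else_)
open import Data.Fin using (Fin; zero; suc)
open import Data.Fin.Permutation using (Permutation′; _⟨$⟩ʳ_)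
open import Data.Product using (Σ-syntax; ∃-syntax)
open import Relation.Binary.PropositionalEquality using (_≡_)

Matrix : ℕ → ℕ → Set
Matrix k n = Fin k → Fin n → Bool

BinSeq : ℕ → Set
BinSeq k = Fin k → Bool

-- M_I(3): rows (1,1,0), (0,1,1), (1,0,1)  (1 = true, 0 = false)
M-I3 : Matrix 3 3
M-I3 zero       zero             = true
M-I3 zero       (suc zero)       = true
M-I3 zero       (suc (suc zero)) = false
M-I3 (suc zero) zero             = false
M-I3 (suc zero) (suc zero)       = true
M-I3 (suc zero) (suc (suc zero)) = true
M-I3 (suc (suc zero)) zero             = true
M-I3 (suc (suc zero)) (suc zero)       = false
M-I3 (suc (suc zero)) (suc (suc zero)) = true

appendZero : ∀ {n} → (Fin n → Bool) → Fin (suc n) → Bool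
appendZero {ℕ.zero}  r zero    = false
appendZero {ℕ.suc n} r zero    = r zero
appendZero {ℕ.suc n} r (suc j) = appendZero (λ j′ → r (suc j′)) j

_* : ∀ {k n} → Matrix k n → Matrix k (suc n)
(M *) i = appendZero (M i)

_⊙_ : ∀ {k n} → BinSeq k → Matrix k n → Matrix k n
(a ⊙ M) i j = if a i then not (M i j) else M i j

SameConfig : ∀ {k n} → Matrix k n → Matrix k n → Set
SameConfig {k} {n} M N =
  Σ[ σ ∈ Permutation′ k ] Σ[ τ ∈ Permutation′ n ]
    (∀ i j → M (σ ⟨$⟩ʳ i) (τ ⟨$⟩ʳ j) ≡ N i j)

000s 111s : BinSeq 3
000s _ = false
111s _ = true

-- The columns 101, 110, 011, 000 of M_I(3)* are the even-weight vectors of 𝔽₂³, and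
-- complementing the rows selected by a adds a to every column. For even a this
-- permutes the columns by a double transposition; for odd a it yields the columns of
-- 111 ⊙ M_I(3)*, permuted in the same way. So the parity of a picks the representative.
-- The two representatives differ because row and column permutations preserve having
-- an all-zero column, which 000 ⊙ M_I(3)* has and 111 ⊙ M_I(3)*, all of whose columns
-- have odd weight, lacks.
module Submission where

open import Defs
open import Data.Bool using (Bool; true; false; not; if_then_else_)
import Data.Bool.Properties as Bool
open import Data.Fin using (Fin; zero; suc; fromℕ; #_)
open import Data.Fin.Permutation using (Permutation′; id; transpose; _∘ₚ_; _⟨$⟩ʳ_; _⟨$⟩ˡ_; inverseʳ)
open import Data.Fin.Properties using (all?; any?)
open import Data.Nat using (ℕ)
open import Data.Product using (_×_; ∃-syntax; _,_)
open import Data.Sum using (_⊎_; inj₁; inj₂)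
open import Relation.Binary.PropositionalEquality using (_≡_; _≗_; refl; sym; trans; cong)
open import Relation.Nullary using (¬_; Dec)
open import Relation.Nullary.Decidable using (True; toWitness; toWitnessFalse)

private
  variable
    k n : ℕ

infix 4 _≐_

_≐_ : Matrix k n → Matrix k n → Set
M ≐ N = ∀ i j → M i j ≡ N i j

_≐?_ : (M N : Matrix k n) → Dec (M ≐ N)
M ≐? N = all? λ i → all? λ j → M i j Bool.≟ N i j

decide-≐ : {M N : Matrix k n} {ok : True (M ≐? N)} → M ≐ N
decide-≐ {M = M} {N} {ok} = toWitness {a? = M ≐? N} ok

SameConfig-respˡ : {M M′ N : Matrix k n} → M ≐ M′ → SameConfig M′ N → SameConfig M N
SameConfig-respˡ M≐M′ (σ , τ , eq) = σ , τ , λ i j → trans (M≐M′ _ _) (eq i j)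

HasZeroColumn : Matrix k n → Set
HasZeroColumn M = ∃[ j ] ∀ i → M i j ≡ false

hasZeroColumn? : (M : Matrix k n) → Dec (HasZeroColumn M)
hasZeroColumn? M = any? λ j → all? λ i → M i j Bool.≟ false

SameConfig-preserves-HasZeroColumn : {M N : Matrix k n} →
                                     SameConfig M N → HasZeroColumn M → HasZeroColumn N
SameConfig-preserves-HasZeroColumn {M = M} (σ , τ , eq) (j , zero-col) =
  τ ⟨$⟩ˡ j , λ i → trans (sym (eq i (τ ⟨$⟩ˡ j)))
                          (trans (cong (M (σ ⟨$⟩ʳ i)) (inverseʳ τ)) (zero-col (σ ⟨$⟩ʳ i)))

appendZero-last : (r : Fin n → Bool) → appendZero r (fromℕ n) ≡ false
appendZero-last {ℕ.zero}  r = refl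
appendZero-last {ℕ.suc n} r = appendZero-last (λ j → r (suc j))

*-HasZeroColumn : (M : Matrix k n) → HasZeroColumn (M *)
*-HasZeroColumn {n = n} M = fromℕ n , λ i → appendZero-last (M i)

⊙-congˡ : {a b : BinSeq k} → a ≗ b → (M : Matrix k n) → a ⊙ M ≐ b ⊙ M
⊙-congˡ a≗b M i j = cong (λ c → if c then not (M i j) else M i j) (a≗b i)

bits : Bool → Bool → Bool → BinSeq 3
bits x y z zero             = x
bits x y z (suc zero)       = y
bits x y z (suc (suc zero)) = z

bits-η : (a : BinSeq 3) → a ≗ bits (a zero) (a (suc zero)) (a (suc (suc zero)))
bits-η a zero             = refl
bits-η a (suc zero)       = refl
bits-η a (suc (suc zero)) = refl

Canonical : BinSeq 3 → Set
Canonical a′ = a′ ≡ 000s ⊎ a′ ≡ 111s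

-- Adding 011, 110, 101 respectively to the columns 101, 110, 011, 000.
τ₀₁ τ₀₂ τ₀₃ : Permutation′ 4
τ₀₁ = transpose (# 0) (# 1) ∘ₚ transpose (# 2) (# 3)
τ₀₂ = transpose (# 0) (# 2) ∘ₚ transpose (# 1) (# 3)
τ₀₃ = transpose (# 0) (# 3) ∘ₚ transpose (# 1) (# 2)

canonicalForm : (x y z : Bool) →
                ∃[ a′ ] (Canonical a′ × SameConfig (bits x y z ⊙ (M-I3 *)) (a′ ⊙ (M-I3 *)))
canonicalForm false false false = 000s , inj₁ refl , id , id , decide-≐
canonicalForm false true  true  = 000s , inj₁ refl , id , τ₀₁ , decide-≐
canonicalForm true  false true  = 000s , inj₁ refl , id , τ₀₃ , decide-≐
canonicalForm true  true  false = 000s , inj₁ refl , id , τ₀₂ , decide-≐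
canonicalForm true  true  true  = 111s , inj₂ refl , id , id , decide-≐
canonicalForm true  false false = 111s , inj₂ refl , id , τ₀₁ , decide-≐
canonicalForm false true  false = 111s , inj₂ refl , id , τ₀₃ , decide-≐
canonicalForm false false true  = 111s , inj₂ refl , id , τ₀₂ , decide-≐

lemma12 : ((a : BinSeq 3) → ∃[ a′ ] ((a′ ≡ 000s ⊎ a′ ≡ 111s) × SameConfig (a ⊙ (M-I3 *)) (a′ ⊙ (M-I3 *))))
          × ¬ SameConfig (000s ⊙ (M-I3 *)) (111s ⊙ (M-I3 *))
lemma12 = reduce , distinct
  where
  reduce : (a : BinSeq 3) → ∃[ a′ ] (Canonical a′ × SameConfig (a ⊙ (M-I3 *)) (a′ ⊙ (M-I3 *)))
  reduce a with canonicalForm (a zero) (a (suc zero)) (a (suc (suc zero)))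
  ... | a′ , canonical , same = a′ , canonical , SameConfig-respˡ (⊙-congˡ (bits-η a) (M-I3 *)) same

  distinct : ¬ SameConfig (000s ⊙ (M-I3 *)) (111s ⊙ (M-I3 *))
  distinct same = no-zero-column (SameConfig-preserves-HasZeroColumn same (*-HasZeroColumn M-I3))
    where
    no-zero-column : ¬ HasZeroColumn (111s ⊙ (M-I3 *))
    no-zero-column = toWitnessFalse {a? = hasZeroColumn? (111s ⊙ (M-I3 *))} _
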